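{- (i) $P_{132,1}(x) = 1$. (ii) $P_{132,12}(x) = \dfrac{1}{1-x}$. (iii) For all $d \ge 3$, $$P_{132,12\ldots d}(x) = \frac{(1-x)\sum_{r=0}^{d-3}(1-x-x^2)^{r+1}x^{d-3-r} + x^{d-2}}{(1-x)(1-x-x^2)^{d-2}}.$$
   Context: $S_n$ is the set of permutations of $\{1,\dots,n\}$ in one-line notation. A permutation avoids a pattern $\sigma\in S_k$ if it has no subsequence of length $k$ whose entries are in the same relative order as $\sigma$. $\mathcal{P}_n(132)$ is the set of permutations in $S_n$ avoiding each of $132$, $2341$, $3241$ (equivalently, the two-stack sortable permutations avoiding $132$), and $\mathcal{P}_0(132)$ contains only the empty permutation. For a pattern $\tau$, $\mathcal{P}_n(132,\tau)$ is the set of elements of $\mathcal{P}_n(132)$ that also avoid $\tau$, and $P_{132,\tau}(x)=\sum_{n\ge 0}|\mathcal{P}_n(132,\tau)|x^n$. Here $12\ldots d$ denotes the identity permutation of length $d$ (the increasing pattern). -}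

module Defs where

open import Data.Bool using (Bool; true; false; _∧_; _∨_; not; if_then_else_)
open import Data.Nat as ℕ using (ℕ; zero; suc; _∸_; _<ᵇ_; _≡ᵇ_)
open import Data.Integer as ℤ using (ℤ; +_; -_) renaming (_+_ to _+ℤ_; _*_ to _*ℤ_)
open import Data.List using (List; []; _∷_; length; map; concatMap; zip; upTo; _++_)
open import Data.Product using (_,_)
open import Relation.Binary.PropositionalEquality using (_≡_)

allᵇ : {A : Set} → (A → Bool) → List A → Bool
allᵇ p []       = true
allᵇ p (x ∷ xs) = p x ∧ allᵇ p xs

anyᵇ : {A : Set} → (A → Bool) → List A → Bool
anyᵇ p []       = false
anyᵇ p (x ∷ xs) = p x ∨ anyᵇ p xs

filterᵇ : {A : Set} → (A → Bool) → List A → List A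
filterᵇ p []       = []
filterᵇ p (x ∷ xs) = if p x then x ∷ filterᵇ p xs else filterᵇ p xs

-- Permutations of {1,…,n} in one-line notation (as lists of ℕ)

insertions : ℕ → List ℕ → List (List ℕ)
insertions x []       = (x ∷ []) ∷ []
insertions x (y ∷ ys) = (x ∷ y ∷ ys) ∷ map (y ∷_) (insertions x ys)

-- S n : the list of all n! permutations of {1,…,n}, each exactly once
-- (obtained by inserting n into every position of each element of S (n-1))
S : ℕ → List (List ℕ)
S zero    = [] ∷ []
S (suc n) = concatMap (insertions (suc n)) (S n)

-- all subsequences (as position-subsets, with multiplicity) of a list
subseqs : List ℕ → List (List ℕ)
subseqs []       = [] ∷ []
subseqs (x ∷ xs) = map (x ∷_) (subseqs xs) ++ subseqs xs

-- same relative order (lists of distinct entries)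
sameOrder : List ℕ → List ℕ → Bool
sameOrder []       []       = true
sameOrder []       (_ ∷ _)  = false
sameOrder (_ ∷ _)  []       = false
sameOrder (x ∷ xs) (y ∷ ys) =
  allᵇ (λ { (x' , y') → ((x <ᵇ x') ≡ᵇᴮ (y <ᵇ y')) ∧ ((x' <ᵇ x) ≡ᵇᴮ (y' <ᵇ y)) }) (zip xs ys)
  ∧ sameOrder xs ys
  where
  _≡ᵇᴮ_ : Bool → Bool → Bool
  true  ≡ᵇᴮ b = b
  false ≡ᵇᴮ b = not b

contains : List ℕ → List ℕ → Bool
contains π σ = anyᵇ (λ s → sameOrder s σ) (subseqs π)

avoids : List ℕ → List ℕ → Bool
avoids π σ = not (contains π σ)

p132 p2341 p3241 : List ℕ
p132  = 1 ∷ 3 ∷ 2 ∷ []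
p2341 = 2 ∷ 3 ∷ 4 ∷ 1 ∷ []
p3241 = 3 ∷ 2 ∷ 4 ∷ 1 ∷ []

incr : ℕ → List ℕ
incr d = map suc (upTo d)

countP : List ℕ → ℕ → ℕ
countP τ n = length (filterᵇ
  (λ π → avoids π p132 ∧ avoids π p2341 ∧ avoids π p3241 ∧ avoids π τ) (S n))

Series : Set
Series = ℕ → ℤ

genP : List ℕ → Series
genP τ n = + countP τ n

cst : ℤ → Series
cst c zero    = c
cst c (suc _) = + 0

X : Series
X (suc zero) = + 1
X _          = + 0

_⊕_ : Series → Series → Series
(f ⊕ g) n = f n +ℤ g n

_⊖_ : Series → Series → Series
(f ⊖ g) n = f n +ℤ (- g n)

-- Cauchy product: (f ⊗ g) n = Σ_{i=0}^{n} f i * g (n - i)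
_⊗_ : Series → Series → Series
(f ⊗ g) n = go n
  where
  go : ℕ → ℤ
  go zero    = f zero *ℤ g n
  go (suc i) = f (suc i) *ℤ g (n ∸ suc i) +ℤ go i

infixl 6 _⊕_ _⊖_
infixl 7 _⊗_

_^ˢ_ : Series → ℕ → Series
f ^ˢ zero  = cst (+ 1)
f ^ˢ suc k = f ⊗ (f ^ˢ k)

infixr 8 _^ˢ_

sumS : ℕ → (ℕ → Series) → Series
sumS zero    f = f zero
sumS (suc m) f = sumS m f ⊕ f (suc m)

_≈ˢ_ : Series → Series → Set
f ≈ˢ g = ∀ n → f n ≡ g n

infix 4 _≈ˢ_

one : Series
one = cst (+ 1)

q : Series
q = one ⊖ X ⊖ X ^ˢ 2

{-# OPTIONS --safe #-}
module Submission where

-- Only the empty permutation avoids 1 and only the decreasing ones avoid 12. For the rest, write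
-- a_d(n) for the number of permutations of length n avoiding 132, 2341, 3241 and 12…d, and build
-- each permutation of length n + 1 by inserting its maximum x into one of length n. If x lands
-- after the second entry but not at the end, the entry c following x together with the two
-- leading entries gives 132, 2341 or 3241. In front, x takes part in no forbidden pattern; at the
-- end it lengthens increasing subsequences by one, giving a_(d-1)(n); right behind the first
-- entry a it forces a = n (else a x n is a 132), and then a and x are both invisible, giving
-- a_d(n-1). So a_d(n+1) = a_d(n) + a_d(n-1) + a_(d-1)(n) for d ≥ 3, n ≥ 2, that is
-- (1 - x - x²) A_d = (1 - x - x²) + x A_(d-1), and the closed form follows by induction on d.

open import Defs
open import Data.Nat using (ℕ; _≤_; _∸_)
open import Data.Product using (_×_)

module PowerSeries where
  open import Algebra.Bundles using (CommutativeRing)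
  import Data.Integer.Properties as ℤₚ
  import Data.Nat.Properties as ℕₚ
  open import Algebra.Properties.CommutativeSemigroup ℤₚ.+-commutativeSemigroup using (interchange; x∙yz≈y∙xz)
  import Algebra.Solver.Ring
  open import Algebra.Solver.Ring.AlmostCommutativeRing using (fromCommutativeRing; _-Raw-AlmostCommutative⟶_)
  open import Data.Integer.Base as ℤ using (ℤ; -_; _+_; _-_; _*_; 0ℤ; 1ℤ)
  open import Data.Integer.Solver using (module +-*-Solver)
  open import Data.Maybe.Base using (Maybe; just; nothing)
  open import Data.Nat.Base as ℕ using (ℕ; zero; suc; _∸_)
  open import Data.Product.Base using (_,_)
  open import Function.Base using (_∘_)
  open import Level using (0ℓ)
  open import Relation.Binary.PropositionalEquality using (_≡_; refl; sym; trans; cong; cong₂; module ≡-Reasoning)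
  import Relation.Binary.Reasoning.Setoid
  open import Relation.Nullary.Decidable.Core using (yes; no)

  shift : Series → Series
  shift f n = f (suc n)

  _·ˢ_ : ℤ → Series → Series
  (c ·ˢ f) n = c * f n

  -- A structurally recursive form of the Cauchy product, used to prove the ring laws.
  infixl 7 _⋆_
  _⋆_ : Series → Series → Series
  (f ⋆ g) zero    = f 0 * g 0
  (f ⋆ g) (suc n) = f 0 * g (suc n) + (shift f ⋆ g) n

  -- `_⊗_` sums its terms with a loop local to its where block; the with-abstraction
  -- below makes the loop occur applied to variables only, so unification names it.
  mutual
    productLoop : Series → Series → ℕ → ℕ → ℤ
    productLoop = _

    ⊗-suc : ∀ f g n → (f ⊗ g) (suc n) ≡ f (suc n) * g (n ∸ n) + productLoop f g (suc n) n
    ⊗-suc f g n with suc n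
    ... | m = refl

  productLoop-suc : ∀ f g n i →
    productLoop f g (suc n) (suc i) ≡ f 0 * g (suc n) + productLoop (shift f) g n i
  productLoop-suc f g n zero    = ℤₚ.+-comm (f 1 * g n) (f 0 * g (suc n))
  productLoop-suc f g n (suc i) = begin
    f (2 ℕ.+ i) * g (n ∸ suc i) + productLoop f g (suc n) (suc i)
      ≡⟨ cong (_+_ (f (2 ℕ.+ i) * g (n ∸ suc i))) (productLoop-suc f g n i) ⟩
    f (2 ℕ.+ i) * g (n ∸ suc i) + (f 0 * g (suc n) + productLoop (shift f) g n i)
      ≡⟨ x∙yz≈y∙xz (f (2 ℕ.+ i) * g (n ∸ suc i)) (f 0 * g (suc n)) _ ⟩
    f 0 * g (suc n) + productLoop (shift f) g n (suc i) ∎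
    where open ≡-Reasoning

  productLoop-diagonal : ∀ n f g → productLoop f g n n ≡ (f ⋆ g) n
  productLoop-diagonal zero    f g = refl
  productLoop-diagonal (suc n) f g =
    trans (productLoop-suc f g n n) (cong (_+_ (f 0 * g (suc n))) (productLoop-diagonal n (shift f) g))

  ⊗≈⋆ : ∀ f g → f ⊗ g ≈ˢ f ⋆ g
  ⊗≈⋆ f g zero    = refl
  ⊗≈⋆ f g (suc n) = trans (⊗-suc f g n) (productLoop-diagonal (suc n) f g)

  ⋆-cong : ∀ {f f′ g g′} → f ≈ˢ f′ → g ≈ˢ g′ → f ⋆ g ≈ˢ f′ ⋆ g′
  ⋆-cong f≈ g≈ zero    = cong₂ _*_ (f≈ 0) (g≈ 0)
  ⋆-cong f≈ g≈ (suc n) = cong₂ _+_ (cong₂ _*_ (f≈ 0) (g≈ (suc n))) (⋆-cong (f≈ ∘ suc) g≈ n)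

  ⋆-zeroˡ : ∀ {f} g → (∀ n → f n ≡ 0ℤ) → ∀ n → (f ⋆ g) n ≡ 0ℤ
  ⋆-zeroˡ g f≡0 zero    = cong (_* g 0) (f≡0 0)
  ⋆-zeroˡ g f≡0 (suc n) = cong₂ _+_ (cong (_* g (suc n)) (f≡0 0)) (⋆-zeroˡ g (f≡0 ∘ suc) n)

  ⋆-identityˡ : ∀ g → one ⋆ g ≈ˢ g
  ⋆-identityˡ g zero    = ℤₚ.*-identityˡ (g 0)
  ⋆-identityˡ g (suc n) = begin
    1ℤ * g (suc n) + (shift one ⋆ g) n
      ≡⟨ cong₂ _+_ (ℤₚ.*-identityˡ (g (suc n))) (⋆-zeroˡ g (λ _ → refl) n) ⟩
    g (suc n) + 0ℤ
      ≡⟨ ℤₚ.+-identityʳ (g (suc n)) ⟩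
    g (suc n) ∎
    where open ≡-Reasoning

  ⋆-distribˡ : ∀ f g h → f ⋆ (g ⊕ h) ≈ˢ f ⋆ g ⊕ f ⋆ h
  ⋆-distribˡ f g h zero    = ℤₚ.*-distribˡ-+ (f 0) (g 0) (h 0)
  ⋆-distribˡ f g h (suc n) =
    trans (cong₂ _+_ (ℤₚ.*-distribˡ-+ (f 0) (g (suc n)) (h (suc n))) (⋆-distribˡ (shift f) g h n))
          (interchange (f 0 * g (suc n)) (f 0 * h (suc n)) _ _)

  ⋆-distribʳ : ∀ f g h → (f ⊕ g) ⋆ h ≈ˢ f ⋆ h ⊕ g ⋆ h
  ⋆-distribʳ f g h zero    = ℤₚ.*-distribʳ-+ (h 0) (f 0) (g 0)
  ⋆-distribʳ f g h (suc n) =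
    trans (cong₂ _+_ (ℤₚ.*-distribʳ-+ (h (suc n)) (f 0) (g 0)) (⋆-distribʳ (shift f) (shift g) h n))
          (interchange (f 0 * h (suc n)) (g 0 * h (suc n)) _ _)

  ⋆-scaleˡ : ∀ c f g → (c ·ˢ f) ⋆ g ≈ˢ c ·ˢ (f ⋆ g)
  ⋆-scaleˡ c f g zero    = ℤₚ.*-assoc c (f 0) (g 0)
  ⋆-scaleˡ c f g (suc n) =
    trans (cong₂ _+_ (ℤₚ.*-assoc c (f 0) (g (suc n))) (⋆-scaleˡ c (shift f) g n))
          (sym (ℤₚ.*-distribˡ-+ c (f 0 * g (suc n)) ((shift f ⋆ g) n)))

  ⋆-suc : ∀ f g n → (f ⋆ g) (suc n) ≡ f (suc n) * g 0 + (f ⋆ shift g) n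
  ⋆-suc f g zero    = ℤₚ.+-comm (f 0 * g 1) (f 1 * g 0)
  ⋆-suc f g (suc n) =
    trans (cong (_+_ (f 0 * g (2 ℕ.+ n))) (⋆-suc (shift f) g n))
          (x∙yz≈y∙xz (f 0 * g (2 ℕ.+ n)) (f (2 ℕ.+ n) * g 0) _)

  ⋆-comm : ∀ f g → f ⋆ g ≈ˢ g ⋆ f
  ⋆-comm f g zero    = ℤₚ.*-comm (f 0) (g 0)
  ⋆-comm f g (suc n) =
    trans (cong₂ _+_ (ℤₚ.*-comm (f 0) (g (suc n))) (⋆-comm (shift f) g n)) (sym (⋆-suc g f n))

  ⋆-assoc : ∀ f g h → (f ⋆ g) ⋆ h ≈ˢ f ⋆ (g ⋆ h)
  ⋆-assoc f g h zero    = ℤₚ.*-assoc (f 0) (g 0) (h 0)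
  ⋆-assoc f g h (suc n) = begin
    -- shift (f ⋆ g) unfolds to f 0 ·ˢ shift g ⊕ shift f ⋆ g
    (f 0 * g 0) * h (suc n) + ((f 0 ·ˢ shift g ⊕ shift f ⋆ g) ⋆ h) n
      ≡⟨ cong (_+_ ((f 0 * g 0) * h (suc n))) (trans (⋆-distribʳ (f 0 ·ˢ shift g) (shift f ⋆ g) h n)
           (cong₂ _+_ (⋆-scaleˡ (f 0) (shift g) h n) (⋆-assoc (shift f) g h n))) ⟩
    (f 0 * g 0) * h (suc n) + (f 0 * (shift g ⋆ h) n + (shift f ⋆ (g ⋆ h)) n)
      ≡⟨ regroup (f 0) (g 0) (h (suc n)) ((shift g ⋆ h) n) ((shift f ⋆ (g ⋆ h)) n) ⟩
    f 0 * (g 0 * h (suc n) + (shift g ⋆ h) n) + (shift f ⋆ (g ⋆ h)) n ∎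
    where
    open ≡-Reasoning
    regroup : ∀ a b c d e → (a * b) * c + (a * d + e) ≡ a * (b * c + d) + e
    regroup = solve 5 (λ a b c d e → (a :* b) :* c :+ (a :* d :+ e) := a :* (b :* c :+ d) :+ e) refl
      where open +-*-Solver

  private
    lift⋆ : ∀ {f g f′ g′} → f ⋆ g ≈ˢ f′ ⋆ g′ → f ⊗ g ≈ˢ f′ ⊗ g′
    lift⋆ {f} {g} {f′} {g′} eq n = trans (⊗≈⋆ f g n) (trans (eq n) (sym (⊗≈⋆ f′ g′ n)))

  ⊗-cong : ∀ {f f′ g g′} → f ≈ˢ f′ → g ≈ˢ g′ → f ⊗ g ≈ˢ f′ ⊗ g′
  ⊗-cong f≈ g≈ = lift⋆ (⋆-cong f≈ g≈)

  ⊗-assoc : ∀ f g h → (f ⊗ g) ⊗ h ≈ˢ f ⊗ (g ⊗ h)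
  ⊗-assoc f g h n = begin
    ((f ⊗ g) ⊗ h) n ≡⟨ ⊗≈⋆ (f ⊗ g) h n ⟩
    ((f ⊗ g) ⋆ h) n ≡⟨ ⋆-cong (⊗≈⋆ f g) (λ _ → refl) n ⟩
    ((f ⋆ g) ⋆ h) n ≡⟨ ⋆-assoc f g h n ⟩
    (f ⋆ (g ⋆ h)) n ≡⟨ ⋆-cong (λ _ → refl) (λ m → sym (⊗≈⋆ g h m)) n ⟩
    (f ⋆ (g ⊗ h)) n ≡⟨ sym (⊗≈⋆ f (g ⊗ h) n) ⟩
    (f ⊗ (g ⊗ h)) n ∎
    where open ≡-Reasoning

  ⊗-distribˡ : ∀ f g h → f ⊗ (g ⊕ h) ≈ˢ f ⊗ g ⊕ f ⊗ h
  ⊗-distribˡ f g h n =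
    trans (⊗≈⋆ f (g ⊕ h) n) (trans (⋆-distribˡ f g h n) (sym (cong₂ _+_ (⊗≈⋆ f g n) (⊗≈⋆ f h n))))

  ⊗-distribʳ : ∀ h f g → (f ⊕ g) ⊗ h ≈ˢ f ⊗ h ⊕ g ⊗ h
  ⊗-distribʳ h f g n =
    trans (⊗≈⋆ (f ⊕ g) h n) (trans (⋆-distribʳ f g h n) (sym (cong₂ _+_ (⊗≈⋆ f h n) (⊗≈⋆ g h n))))

  ⊗-identityˡ : ∀ f → one ⊗ f ≈ˢ f
  ⊗-identityˡ f n = trans (⊗≈⋆ one f n) (⋆-identityˡ f n)

  ⊗-comm : ∀ f g → f ⊗ g ≈ˢ g ⊗ f
  ⊗-comm f g = lift⋆ (⋆-comm f g)

  series-commutativeRing : CommutativeRing 0ℓ 0ℓ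
  series-commutativeRing = record
    { Carrier = Series ; _≈_ = _≈ˢ_ ; _+_ = _⊕_ ; _*_ = _⊗_ ; -_ = λ f n → - f n ; 0# = λ _ → 0ℤ ; 1# = one
    ; isCommutativeRing = record
      { isRing = record
        { +-isAbelianGroup = record
          { isGroup = record
            { isMonoid = record
              { isSemigroup = record
                { isMagma = record
                  { isEquivalence = record
                    { refl = λ _ → refl ; sym = λ eq n → sym (eq n) ; trans = λ eq eq′ n → trans (eq n) (eq′ n) }
                  ; ∙-cong = λ eq eq′ n → cong₂ _+_ (eq n) (eq′ n) }
                ; assoc = λ f g h n → ℤₚ.+-assoc (f n) (g n) (h n) }
              ; identity = (λ f n → ℤₚ.+-identityˡ (f n)) , (λ f n → ℤₚ.+-identityʳ (f n)) }
            ; inverse = (λ f n → ℤₚ.+-inverseˡ (f n)) , (λ f n → ℤₚ.+-inverseʳ (f n))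
            ; ⁻¹-cong = λ eq n → cong -_ (eq n) }
          ; comm = λ f g n → ℤₚ.+-comm (f n) (g n) }
        ; *-cong = ⊗-cong
        ; *-assoc = ⊗-assoc
        ; *-identity = ⊗-identityˡ , λ f n → trans (⊗-comm f one n) (⊗-identityˡ f n)
        ; distrib = ⊗-distribˡ , ⊗-distribʳ
        }
      ; *-comm = ⊗-comm
      }
    }

  cst-homomorphism : ℤ.+-*-rawRing -Raw-AlmostCommutative⟶ fromCommutativeRing series-commutativeRing
  cst-homomorphism = record
    { ⟦_⟧    = cst
    ; +-homo = λ { a b zero → refl ; a b (suc n) → refl }
    ; *-homo = λ { a b zero → refl ; a b (suc n) → sym (trans (⊗≈⋆ (cst a) (cst b) (suc n)) (constant a b n)) }
    ; -‿homo = λ { a zero → refl ; a (suc n) → refl }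
    ; 0-homo = λ { zero → refl ; (suc n) → refl }
    ; 1-homo = λ { zero → refl ; (suc n) → refl }
    }
    where
    constant : ∀ a b n → (cst a ⋆ cst b) (suc n) ≡ 0ℤ
    constant a b n = trans (cong₂ _+_ (ℤₚ.*-zeroʳ a) (⋆-zeroˡ (cst b) (λ _ → refl) n)) (ℤₚ.+-identityˡ 0ℤ)

  cst-≟ : (a b : ℤ) → Maybe (cst a ≈ˢ cst b)
  cst-≟ a b with a ℤₚ.≟ b
  ... | yes refl = just (λ _ → refl)
  ... | no _     = nothing

  module SeriesSolver =
    Algebra.Solver.Ring ℤ.+-*-rawRing (fromCommutativeRing series-commutativeRing) cst-homomorphism cst-≟

  open CommutativeRing series-commutativeRing using (+-cong; *-cong; *-identityʳ)
    renaming (refl to ≈-refl; sym to ≈-sym; trans to ≈-trans)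
  module ≈-Reasoning = Relation.Binary.Reasoning.Setoid (CommutativeRing.setoid series-commutativeRing)

  X⊗-suc : ∀ f n → (X ⊗ f) (suc n) ≡ f n
  X⊗-suc f n = begin
    (X ⊗ f) (suc n)                  ≡⟨ ⊗≈⋆ X f (suc n) ⟩
    0ℤ * f (suc n) + (shift X ⋆ f) n ≡⟨ ℤₚ.+-identityˡ _ ⟩
    (shift X ⋆ f) n                  ≡⟨ ⋆-cong shiftX≈one (λ _ → refl) n ⟩
    (one ⋆ f) n                      ≡⟨ ⋆-identityˡ f n ⟩
    f n                              ∎
    where
    open ≡-Reasoning
    shiftX≈one : shift X ≈ˢ one
    shiftX≈one zero    = refl
    shiftX≈one (suc n) = refl

  q⊗-expand : ∀ f → q ⊗ f ≈ˢ f ⊖ X ⊗ f ⊖ X ⊗ (X ⊗ f)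
  q⊗-expand f = SeriesSolver.solve 2
    (λ x f → (con 1ℤ :- x :- x :* (x :* con 1ℤ)) :* f := f :- x :* f :- x :* (x :* f)) (λ _ → refl) X f
    where open SeriesSolver using (_:-_; _:*_; _:=_; con)

  q⊗-coeff-suc : ∀ f n → (q ⊗ f) (suc n) ≡ f (suc n) - f n - (X ⊗ f) n
  q⊗-coeff-suc f n = begin
    (q ⊗ f) (suc n)
      ≡⟨ q⊗-expand f (suc n) ⟩
    f (suc n) - (X ⊗ f) (suc n) - (X ⊗ (X ⊗ f)) (suc n)
      ≡⟨ cong₂ (λ a b → f (suc n) - a - b) (X⊗-suc f n) (X⊗-suc (X ⊗ f) n) ⟩
    f (suc n) - f n - (X ⊗ f) n ∎
    where open ≡-Reasoning

  q-coeff-3+ : ∀ m → q (3 ℕ.+ m) ≡ 0ℤ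
  q-coeff-3+ m = cong (λ a → 0ℤ - 0ℤ - a) (trans (X⊗-suc (X ⊗ one) (2 ℕ.+ m)) (X⊗-suc one (suc m)))

  q⊗-recurrence : ∀ {f g} → f 0 ≡ 1ℤ → f 1 ≡ 1ℤ → f 2 ≡ ℤ.+ 2 → g 0 ≡ 1ℤ → g 1 ≡ 1ℤ →
    (∀ m → f (3 ℕ.+ m) ≡ f (2 ℕ.+ m) + f (1 ℕ.+ m) + g (2 ℕ.+ m)) → q ⊗ f ≈ˢ q ⊕ X ⊗ g
  q⊗-recurrence {f} {g} f₀ f₁ f₂ g₀ g₁ rec = coeff
    where
    open ≡-Reasoning
    coeff : q ⊗ f ≈ˢ q ⊕ X ⊗ g
    coeff 0 = trans (ℤₚ.*-identityˡ (f 0)) f₀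
    coeff 1 = begin
      (q ⊗ f) 1              ≡⟨ q⊗-coeff-suc f 0 ⟩
      f 1 - f 0 - 0ℤ         ≡⟨ cong₂ (λ a b → a - b - 0ℤ) f₁ f₀ ⟩
      0ℤ                     ≡⟨ cong (q 1 +_) (trans (X⊗-suc g 0) g₀) ⟨
      q 1 + (X ⊗ g) 1        ∎
    coeff 2 = begin
      (q ⊗ f) 2              ≡⟨ q⊗-coeff-suc f 1 ⟩
      f 2 - f 1 - (X ⊗ f) 1  ≡⟨ cong₂ (λ a b → a - f 1 - b) f₂ (X⊗-suc f 0) ⟩
      ℤ.+ 2 - f 1 - f 0      ≡⟨ cong₂ (λ a b → ℤ.+ 2 - a - b) f₁ f₀ ⟩
      0ℤ                     ≡⟨ cong (q 2 +_) (trans (X⊗-suc g 1) g₁) ⟨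
      q 2 + (X ⊗ g) 2        ∎
    coeff (suc (suc (suc m))) = begin
      (q ⊗ f) (3 ℕ.+ m)
        ≡⟨ q⊗-coeff-suc f (2 ℕ.+ m) ⟩
      f (3 ℕ.+ m) - f (2 ℕ.+ m) - (X ⊗ f) (2 ℕ.+ m)
        ≡⟨ cong₂ (λ a b → a - f (2 ℕ.+ m) - b) (rec m) (X⊗-suc f (suc m)) ⟩
      f (2 ℕ.+ m) + f (1 ℕ.+ m) + g (2 ℕ.+ m) - f (2 ℕ.+ m) - f (1 ℕ.+ m)
        ≡⟨ cancel (f (2 ℕ.+ m)) (f (1 ℕ.+ m)) (g (2 ℕ.+ m)) ⟩
      0ℤ + g (2 ℕ.+ m)
        ≡⟨ cong₂ _+_ (q-coeff-3+ m) (X⊗-suc g (2 ℕ.+ m)) ⟨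
      q (3 ℕ.+ m) + (X ⊗ g) (3 ℕ.+ m) ∎
      where
      cancel : ∀ a b c → a + b + c - a - b ≡ 0ℤ + c
      cancel = solve 3 (λ a b c → a :+ b :+ c :- a :- b := con 0ℤ :+ c) refl
        where open +-*-Solver

  sumS-cong : ∀ m {F G : ℕ → Series} → (∀ r → r ℕ.≤ m → F r ≈ˢ G r) → sumS m F ≈ˢ sumS m G
  sumS-cong zero    F≈G = F≈G 0 ℕ.z≤n
  sumS-cong (suc m) F≈G =
    +-cong (sumS-cong m (λ r r≤m → F≈G r (ℕₚ.m≤n⇒m≤1+n r≤m))) (F≈G (suc m) ℕₚ.≤-refl)

  ⊗-sumS : ∀ h m (F : ℕ → Series) → h ⊗ sumS m F ≈ˢ sumS m (λ r → h ⊗ F r)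
  ⊗-sumS h zero    F = ≈-refl
  ⊗-sumS h (suc m) F = ≈-trans (⊗-distribˡ h (sumS m F) (F (suc m))) (+-cong (⊗-sumS h m F) ≈-refl)

  ^ˢ-cong : ∀ f {k l} → k ≡ l → f ^ˢ k ≈ˢ f ^ˢ l
  ^ˢ-cong f refl = ≈-refl

  qxSum : ℕ → Series
  qxSum e = sumS e (λ r → q ^ˢ (r ℕ.+ 1) ⊗ X ^ˢ (e ∸ r))

  qxSum-suc : ∀ e → qxSum (suc e) ≈ˢ X ⊗ qxSum e ⊕ q ^ˢ (2 ℕ.+ e)
  qxSum-suc e = +-cong (≈-sym (≈-trans (⊗-sumS X e _) (sumS-cong e shifted))) top
    where
    open ≈-Reasoning
    shifted : ∀ r → r ℕ.≤ e →
              X ⊗ (q ^ˢ (r ℕ.+ 1) ⊗ X ^ˢ (e ∸ r)) ≈ˢ q ^ˢ (r ℕ.+ 1) ⊗ X ^ˢ (suc e ∸ r)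
    shifted r r≤e = begin
      X ⊗ (q ^ˢ (r ℕ.+ 1) ⊗ X ^ˢ (e ∸ r))
        ≈⟨ SeriesSolver.solve 3 (λ x a b → x :* (a :* b) := a :* (x :* b)) ≈-refl X _ _ ⟩
      q ^ˢ (r ℕ.+ 1) ⊗ X ^ˢ suc (e ∸ r)
        ≈⟨ *-cong ≈-refl (^ˢ-cong X (sym (ℕₚ.+-∸-assoc 1 r≤e))) ⟩
      q ^ˢ (r ℕ.+ 1) ⊗ X ^ˢ (suc e ∸ r) ∎
      where open SeriesSolver using (_:*_; _:=_)
    top : q ^ˢ (suc e ℕ.+ 1) ⊗ X ^ˢ (e ∸ e) ≈ˢ q ^ˢ (2 ℕ.+ e)
    top = ≈-trans (*-cong (^ˢ-cong q (cong suc (ℕₚ.+-comm e 1))) (^ˢ-cong X (ℕₚ.n∸n≡0 e))) (*-identityʳ _)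

  closedForm : ℕ → Series
  closedForm e = (one ⊖ X) ⊗ qxSum e ⊕ X ^ˢ suc e

  closedForm-suc : ∀ e → (one ⊖ X) ⊗ q ^ˢ (2 ℕ.+ e) ⊕ X ⊗ closedForm e ≈ˢ closedForm (suc e)
  closedForm-suc e = begin
    (one ⊖ X) ⊗ q ^ˢ (2 ℕ.+ e) ⊕ X ⊗ ((one ⊖ X) ⊗ qxSum e ⊕ X ^ˢ suc e)
      ≈⟨ SeriesSolver.solve 4 (λ x t s y → (con 1ℤ :- x) :* t :+ x :* ((con 1ℤ :- x) :* s :+ y)
                                          := (con 1ℤ :- x) :* (x :* s :+ t) :+ x :* y) ≈-refl
           X (q ^ˢ (2 ℕ.+ e)) (qxSum e) (X ^ˢ suc e) ⟩
    (one ⊖ X) ⊗ (X ⊗ qxSum e ⊕ q ^ˢ (2 ℕ.+ e)) ⊕ X ^ˢ (2 ℕ.+ e)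
      ≈⟨ +-cong (*-cong ≈-refl (≈-sym (qxSum-suc e))) ≈-refl ⟩
    closedForm (suc e) ∎
    where
    open ≈-Reasoning
    open SeriesSolver using (_:+_; _:-_; _:*_; _:=_; con)

  closedForm-from-recurrence : (A : ℕ → Series) → (one ⊖ X) ⊗ A 2 ≈ˢ one →
    (∀ k → q ⊗ A (3 ℕ.+ k) ≈ˢ q ⊕ X ⊗ A (2 ℕ.+ k)) →
    ∀ e → (one ⊖ X) ⊗ q ^ˢ suc e ⊗ A (3 ℕ.+ e) ≈ˢ closedForm e
  closedForm-from-recurrence A A₂ qA = solution
    where
    open ≈-Reasoning
    C : ℕ → Series
    C k = (one ⊖ X) ⊗ q ^ˢ k ⊗ A (2 ℕ.+ k)

    step : ∀ k → C (suc k) ≈ˢ (one ⊖ X) ⊗ q ^ˢ suc k ⊕ X ⊗ C k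
    step k = begin
      (one ⊖ X) ⊗ (q ⊗ q ^ˢ k) ⊗ A (3 ℕ.+ k)
        ≈⟨ solve 4 (λ x t u a → (con 1ℤ :- x) :* (t :* u) :* a
                               := (con 1ℤ :- x) :* u :* (t :* a)) ≈-refl X q (q ^ˢ k) _ ⟩
      (one ⊖ X) ⊗ q ^ˢ k ⊗ (q ⊗ A (3 ℕ.+ k))
        ≈⟨ *-cong ≈-refl (qA k) ⟩
      (one ⊖ X) ⊗ q ^ˢ k ⊗ (q ⊕ X ⊗ A (2 ℕ.+ k))
        ≈⟨ solve 4 (λ x t u a → (con 1ℤ :- x) :* u :* (t :+ x :* a)
                               := (con 1ℤ :- x) :* (t :* u) :+ x :* ((con 1ℤ :- x) :* u :* a)) ≈-refl X q (q ^ˢ k) _ ⟩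
      (one ⊖ X) ⊗ q ^ˢ suc k ⊕ X ⊗ C k ∎
      where open SeriesSolver using (solve; _:+_; _:-_; _:*_; _:=_; con)

    solution : ∀ e → C (suc e) ≈ˢ closedForm e
    solution zero = begin
      C 1
        ≈⟨ step 0 ⟩
      (one ⊖ X) ⊗ q ^ˢ 1 ⊕ X ⊗ C 0
        ≈⟨ +-cong (*-cong ≈-refl (≈-sym (*-identityʳ _)))
                  (*-cong ≈-refl (≈-trans (*-cong (*-identityʳ _) ≈-refl) A₂)) ⟩
      closedForm 0 ∎
    solution (suc e) = begin
      C (2 ℕ.+ e)
        ≈⟨ step (suc e) ⟩
      (one ⊖ X) ⊗ q ^ˢ (2 ℕ.+ e) ⊕ X ⊗ C (suc e)
        ≈⟨ +-cong (≈-refl {(one ⊖ X) ⊗ q ^ˢ (2 ℕ.+ e)}) (*-cong (≈-refl {X}) (solution e)) ⟩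
      (one ⊖ X) ⊗ q ^ˢ (2 ℕ.+ e) ⊕ X ⊗ closedForm e
        ≈⟨ closedForm-suc e ⟩
      closedForm (suc e) ∎

  geometric-series : ∀ {f} → (∀ n → f n ≡ 1ℤ) → (one ⊖ X) ⊗ f ≈ˢ one
  geometric-series {f} f≡1 = ≈-trans expand coeff
    where
    expand : (one ⊖ X) ⊗ f ≈ˢ f ⊖ X ⊗ f
    expand = SeriesSolver.solve 2 (λ x f → (con 1ℤ :- x) :* f := f :- x :* f) (λ _ → refl) X f
      where open SeriesSolver using (_:-_; _:*_; _:=_; con)
    coeff : f ⊖ X ⊗ f ≈ˢ one
    coeff zero    = cong (_- 0ℤ) (f≡1 0)
    coeff (suc n) = cong₂ _-_ (f≡1 (suc n)) (trans (X⊗-suc f n) (f≡1 n))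

module Patterns where
  import Data.Nat.Properties as ℕₚ
  open import Algebra.Properties.CommutativeSemigroup ℕₚ.+-commutativeSemigroup using (interchange)
  open import Data.Bool.Base using (Bool; true; false; T; _∧_; not; if_then_else_)
  open import Data.Bool.Properties using (T-∧; T-∨; T-not-≡)
  open import Data.Empty using (⊥; ⊥-elim)
  open import Data.List.Base using (List; []; _∷_; [_]; _++_; map; zip; length; upTo; concatMap)
  open import Data.List.Membership.Propositional using (_∈_; find; lose)
  open import Data.List.Membership.Propositional.Properties using (∈-++⁺ˡ; ∈-++⁺ʳ; ∈-++⁻; ∈-map⁺; ∈-map⁻)
  open import Data.List.Properties using (length-map; length-upTo; length-++; map-cong-local; map-∘)
  open import Data.List.Relation.Binary.Pointwise as Pointwise using (Pointwise; []; _∷_)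
  open import Data.List.Relation.Binary.Sublist.Propositional
    using (_⊆_; []; _∷_; _∷ʳ_; ⊆-refl; ⊆-trans; minimum; from∈)
  open import Data.List.Relation.Binary.Sublist.Propositional.Properties using (++⁺; ++⁺ˡ; ++⁺ʳ; ∷ˡ⁻; All-resp-⊆)
  open import Data.List.Relation.Unary.All as All using (All; []; _∷_)
  import Data.List.Relation.Unary.All.Properties as AllP
  open import Data.List.Relation.Unary.AllPairs using (AllPairs; []; _∷_)
  import Data.List.Relation.Unary.AllPairs.Properties as AllPairs
  open import Data.List.Relation.Unary.Any using (Any; here; there)
  open import Data.List.Relation.Unary.Unique.Propositional using (Unique)
  open import Data.Nat.Base using (ℕ; zero; suc; pred; _+_; _<_; _<ᵇ_; s<s)
  open import Data.Nat.ListAction using (sum)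
  open import Data.Nat.Properties using (<ᵇ⇒<; <⇒<ᵇ; <-asym; <-trans; <-cmp)
  open import Data.Product.Base using (∃-syntax; Σ-syntax; _×_; _,_; proj₁; proj₂)
  open import Data.Product.Function.NonDependent.Propositional using (_×-⇔_)
  open import Data.Sum.Base as Sum using (_⊎_; inj₁; inj₂; [_,_]′)
  open import Data.Unit.Base using (tt)
  open import Function.Base using (_∘_; id; const)
  open import Function.Bundles using (_⇔_; mk⇔; Equivalence)
  open import Function.Construct.Composition using (_⇔-∘_)
  open import Function.Construct.Symmetry using (⇔-sym)
  open import Relation.Binary.Definitions using (Tri; tri<; tri≈; tri>)
  open import Relation.Binary.PropositionalEquality
    using (_≡_; _≢_; refl; sym; trans; cong; cong₂; subst; module ≡-Reasoning)
  open import Relation.Nullary.Negation using (¬_)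

  open Equivalence using (to; from)

  SameCmp : ℕ → ℕ → ℕ → ℕ → Set
  SameCmp x a y b = (x < a ⇔ y < b) × (a < x ⇔ b < y)

  -- Order isomorphism, structured like `sameOrder`: each head is compared with all later entries.
  infix 4 _≅_
  data _≅_ : List ℕ → List ℕ → Set where
    []  : [] ≅ []
    _∷_ : ∀ {x y xs ys} → Pointwise (λ a b → SameCmp x a y b) xs ys → xs ≅ ys → x ∷ xs ≅ y ∷ ys

  ≅-length : ∀ {s p} → s ≅ p → length s ≡ length p
  ≅-length []        = refl
  ≅-length (_ ∷ s≅p) = cong suc (≅-length s≅p)

  below-head : ∀ {x y xs ys} → Pointwise (λ a b → SameCmp x a y b) xs ys → All (_< x) xs → All (_< y) ys
  below-head []           []           = []
  below-head (x~y ∷ pw) (a<x ∷ as<x) = to (proj₂ x~y) a<x ∷ below-head pw as<x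

  above-head : ∀ {x y xs ys} → Pointwise (λ a b → SameCmp x a y b) xs ys → All (y <_) ys → All (x <_) xs
  above-head []           []           = []
  above-head (x~y ∷ pw) (y<b ∷ y<bs) = from (proj₁ x~y) y<b ∷ above-head pw y<bs

  sameCmp-< : ∀ {x a y b} → x < a → y < b → SameCmp x a y b
  sameCmp-< x<a y<b = mk⇔ (const y<b) (const x<a) , mk⇔ (⊥-elim ∘ <-asym x<a) (⊥-elim ∘ <-asym y<b)

  sameCmp-> : ∀ {x a y b} → a < x → b < y → SameCmp x a y b
  sameCmp-> a<x b<y = mk⇔ (⊥-elim ∘ <-asym a<x) (⊥-elim ∘ <-asym b<y) , mk⇔ (const b<y) (const a<x)

  -- `sameOrder` compares pairs with a function local to its where block; unification names it.
  mutual
    pairTest : ℕ → List ℕ → ℕ → List ℕ → ℕ × ℕ → Bool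
    pairTest = _

    sameOrder-∷ : ∀ x xs y ys →
      sameOrder (x ∷ xs) (y ∷ ys) ≡ (allᵇ (pairTest x xs y ys) (zip xs ys) ∧ sameOrder xs ys)
    sameOrder-∷ x xs y ys = refl

  T-xnor : ∀ c d → T (if c then d else not d) ⇔ (T c ⇔ T d)
  T-xnor true  true  = mk⇔ (const (mk⇔ id id)) (const tt)
  T-xnor true  false = mk⇔ (λ ()) (λ c⇔d → to c⇔d tt)
  T-xnor false true  = mk⇔ (λ ()) (λ c⇔d → from c⇔d tt)
  T-xnor false false = mk⇔ (const (mk⇔ id id)) (const tt)

  T-<ᵇ : ∀ m n → T (m <ᵇ n) ⇔ m < n
  T-<ᵇ m n = mk⇔ (<ᵇ⇒< m n) <⇒<ᵇ

  T-xnor-<ᵇ : ∀ x a y b → T (if x <ᵇ a then y <ᵇ b else not (y <ᵇ b)) ⇔ (x < a ⇔ y < b)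
  T-xnor-<ᵇ x a y b = mk⇔
    (λ t → T-<ᵇ y b ⇔-∘ (to (T-xnor (x <ᵇ a) (y <ᵇ b)) t ⇔-∘ ⇔-sym (T-<ᵇ x a)))
    (λ e → from (T-xnor (x <ᵇ a) (y <ᵇ b)) (⇔-sym (T-<ᵇ y b) ⇔-∘ (e ⇔-∘ T-<ᵇ x a)))

  pairTest-xnor : ∀ x xs y ys a b → pairTest x xs y ys (a , b) ≡
    ((if x <ᵇ a then y <ᵇ b else not (y <ᵇ b)) ∧ (if a <ᵇ x then b <ᵇ y else not (b <ᵇ y)))
  pairTest-xnor x xs y ys a b with x <ᵇ a | a <ᵇ x
  ... | true  | true  = refl
  ... | true  | false = refl
  ... | false | true  = refl
  ... | false | false = refl

  T-pairTest : ∀ x xs y ys a b → T (pairTest x xs y ys (a , b)) ⇔ SameCmp x a y b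
  T-pairTest x xs y ys a b rewrite pairTest-xnor x xs y ys a b =
    (T-xnor-<ᵇ x a y b ×-⇔ T-xnor-<ᵇ a x b y) ⇔-∘ T-∧

  T-allᵇ-zip⁻ : ∀ (F : ℕ × ℕ → Bool) {xs ys} → length xs ≡ length ys →
    T (allᵇ F (zip xs ys)) → Pointwise (λ a b → T (F (a , b))) xs ys
  T-allᵇ-zip⁻ F {[]}     {[]}     _    _ = []
  T-allᵇ-zip⁻ F {x ∷ xs} {y ∷ ys} |xs| t =
    proj₁ (to T-∧ t) ∷ T-allᵇ-zip⁻ F (cong pred |xs|) (proj₂ (to T-∧ t))

  T-allᵇ-zip⁺ : ∀ (F : ℕ × ℕ → Bool) {xs ys} →
    Pointwise (λ a b → T (F (a , b))) xs ys → T (allᵇ F (zip xs ys))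
  T-allᵇ-zip⁺ F []         = tt
  T-allᵇ-zip⁺ F (t ∷ pw)   = from T-∧ (t , T-allᵇ-zip⁺ F pw)

  T-sameOrder : ∀ s p → T (sameOrder s p) ⇔ s ≅ p
  T-sameOrder []       []       = mk⇔ (const []) (const tt)
  T-sameOrder []       (_ ∷ _)  = mk⇔ (λ ()) (λ ())
  T-sameOrder (_ ∷ _)  []       = mk⇔ (λ ()) (λ ())
  T-sameOrder (x ∷ xs) (y ∷ ys) = mk⇔ sound complete
    where
    sound : T (sameOrder (x ∷ xs) (y ∷ ys)) → x ∷ xs ≅ y ∷ ys
    sound t with to T-∧ t
    ... | heads , tails = Pointwise.map (λ {a} {b} → to (T-pairTest x xs y ys a b))
                            (T-allᵇ-zip⁻ (pairTest x xs y ys) (≅-length rest) heads) ∷ rest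
      where rest = to (T-sameOrder xs ys) tails
    complete : x ∷ xs ≅ y ∷ ys → T (sameOrder (x ∷ xs) (y ∷ ys))
    complete (pw ∷ rest) = from T-∧
      (T-allᵇ-zip⁺ (pairTest x xs y ys) (Pointwise.map (λ {a} {b} → from (T-pairTest x xs y ys a b)) pw)
      , from (T-sameOrder xs ys) rest)

  Occurs : List ℕ → List ℕ → Set
  Occurs p π = ∃[ s ] s ⊆ π × s ≅ p

  T-anyᵇ : ∀ {A : Set} (P : A → Bool) xs → T (anyᵇ P xs) ⇔ Any (T ∘ P) xs
  T-anyᵇ P []       = mk⇔ (λ ()) (λ ())
  T-anyᵇ P (x ∷ xs) = mk⇔
    ([ here , there ∘ to (T-anyᵇ P xs) ]′ ∘ to (T-∨ {P x}))
    (from (T-∨ {P x}) ∘ λ { (here px) → inj₁ px ; (there pxs) → inj₂ (from (T-anyᵇ P xs) pxs) })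

  ∈-subseqs⁺ : ∀ {s π} → s ⊆ π → s ∈ subseqs π
  ∈-subseqs⁺ []                      = here refl
  ∈-subseqs⁺ (_∷ʳ_ {ys = π} x s⊆π)   = ∈-++⁺ʳ (map (x ∷_) (subseqs π)) (∈-subseqs⁺ s⊆π)
  ∈-subseqs⁺ (refl ∷ s⊆π)            = ∈-++⁺ˡ (∈-map⁺ _ (∈-subseqs⁺ s⊆π))

  ∈-subseqs⁻ : ∀ {s} π → s ∈ subseqs π → s ⊆ π
  ∈-subseqs⁻ []      (here refl) = []
  ∈-subseqs⁻ (x ∷ π) s∈ with ∈-++⁻ (map (x ∷_) (subseqs π)) s∈
  ... | inj₁ s∈map with ∈-map⁻ _ s∈map
  ...   | _ , s′∈ , refl = refl ∷ ∈-subseqs⁻ π s′∈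
  ∈-subseqs⁻ (x ∷ π) s∈ | inj₂ s∈′ = x ∷ʳ ∈-subseqs⁻ π s∈′

  T-contains : ∀ π p → T (contains π p) ⇔ Occurs p π
  T-contains π p = mk⇔ sound complete
    where
    sound : T (contains π p) → Occurs p π
    sound t with find (to (T-anyᵇ (λ s → sameOrder s p) (subseqs π)) t)
    ... | s , s∈ , ts = s , ∈-subseqs⁻ π s∈ , to (T-sameOrder s p) ts
    complete : Occurs p π → T (contains π p)
    complete (s , s⊆π , s≅p) =
      from (T-anyᵇ (λ s → sameOrder s p) (subseqs π)) (lose (∈-subseqs⁺ s⊆π) (from (T-sameOrder s p) s≅p))

  T-injective : ∀ {b c} → (T b ⇔ T c) → b ≡ c
  T-injective {true}  {true}  _   = refl
  T-injective {true}  {false} b⇔c = ⊥-elim (to b⇔c tt)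
  T-injective {false} {true}  b⇔c = ⊥-elim (from b⇔c tt)
  T-injective {false} {false} _   = refl

  occurs-⊆ : ∀ {p π π′} → π ⊆ π′ → Occurs p π → Occurs p π′
  occurs-⊆ π⊆π′ (s , s⊆π , s≅p) = s , ⊆-trans s⊆π π⊆π′ , s≅p

  contains-≡ : ∀ {p π π′} → π′ ⊆ π → (Occurs p π → Occurs p π′) → contains π p ≡ contains π′ p
  contains-≡ {p} {π} {π′} π′⊆π restrict =
    T-injective (⇔-sym (T-contains π′ p) ⇔-∘ (mk⇔ restrict (occurs-⊆ π′⊆π) ⇔-∘ T-contains π p))

  ⊆-∷ʳ⁻ : ∀ {s : List ℕ} {x} σ → s ⊆ σ ++ [ x ] →
          s ⊆ σ ⊎ Σ[ s′ ∈ List ℕ ] s ≡ s′ ++ [ x ] × s′ ⊆ σ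
  ⊆-∷ʳ⁻ []      (_ ∷ʳ [])   = inj₁ []
  ⊆-∷ʳ⁻ []      (refl ∷ []) = inj₂ ([] , refl , [])
  ⊆-∷ʳ⁻ (c ∷ σ) (_ ∷ʳ s⊆)   =
    Sum.map (c ∷ʳ_) (λ (s′ , eq , s′⊆) → s′ , eq , c ∷ʳ s′⊆) (⊆-∷ʳ⁻ σ s⊆)
  ⊆-∷ʳ⁻ (c ∷ σ) (refl ∷ s⊆) =
    Sum.map (refl ∷_) (λ (s′ , eq , s′⊆) → c ∷ s′ , cong (c ∷_) eq , refl ∷ s′⊆) (⊆-∷ʳ⁻ σ s⊆)

  Pointwise-last : ∀ {R : ℕ → ℕ → Set} {x z} s p → Pointwise R (s ++ [ x ]) (p ++ [ z ]) → R x z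
  Pointwise-last []          []          (r ∷ []) = r
  Pointwise-last []          (_ ∷ [])    (_ ∷ ())
  Pointwise-last []          (_ ∷ _ ∷ _) (_ ∷ ())
  Pointwise-last (_ ∷ [])    []          (_ ∷ ())
  Pointwise-last (_ ∷ _ ∷ _) []          (_ ∷ ())
  Pointwise-last (_ ∷ s)     (_ ∷ p)     (_ ∷ rs) = Pointwise-last s p rs

  ≅-∷ʳ-max : ∀ {x z} s p → s ++ [ x ] ≅ p ++ [ z ] → All (_< x) s → All (_< z) p
  ≅-∷ʳ-max []          []          _           []          = []
  ≅-∷ʳ-max []          (_ ∷ [])    (_ ∷ ())    _
  ≅-∷ʳ-max []          (_ ∷ _ ∷ _) (_ ∷ ())    _
  ≅-∷ʳ-max (_ ∷ [])    []          (_ ∷ ())    _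
  ≅-∷ʳ-max (_ ∷ _ ∷ _) []          (_ ∷ ())    _
  ≅-∷ʳ-max (_ ∷ s)     (_ ∷ p)     (pw ∷ rest) (c<x ∷ s<x) =
    to (proj₁ (Pointwise-last s p pw)) c<x ∷ ≅-∷ʳ-max s p rest s<x

  not-all-below : ∀ {y p} → All (_< y) p → ¬ Any (y <_) p
  not-all-below p<y = AllP.All¬⇒¬Any (All.map (λ b<y y<b → <-asym y<b b<y) p<y)

  contains-∷-max : ∀ {x σ y p} → All (_< x) σ → Any (y <_) p →
    contains (x ∷ σ) (y ∷ p) ≡ contains σ (y ∷ p)
  contains-∷-max {x} {σ} {y} {p} σ<x y<p = contains-≡ {y ∷ p} {x ∷ σ} (x ∷ʳ ⊆-refl) λ where
    (s , _ ∷ʳ s⊆σ , s≅p)                 → s , s⊆σ , s≅p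
    (_ , refl ∷ s⊆σ , pw ∷ _) → ⊥-elim (not-all-below (below-head pw (All-resp-⊆ s⊆σ σ<x)) y<p)

  contains-∷ʳ-max : ∀ {x σ z} p → All (_< x) σ → Any (z <_) p →
    contains (σ ++ [ x ]) (p ++ [ z ]) ≡ contains σ (p ++ [ z ])
  contains-∷ʳ-max {x} {σ} {z} p σ<x z<p = contains-≡ {p ++ [ z ]} {σ ++ [ x ]} (++⁺ʳ [ x ] ⊆-refl) restrict
    where
    restrict : Occurs (p ++ [ z ]) (σ ++ [ x ]) → Occurs (p ++ [ z ]) σ
    restrict (s , s⊆ , s≅p) with ⊆-∷ʳ⁻ σ s⊆
    ... | inj₁ s⊆σ                = s , s⊆σ , s≅p
    ... | inj₂ (s′ , refl , s′⊆σ) =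
      ⊥-elim (not-all-below (≅-∷ʳ-max s′ p s≅p (All-resp-⊆ s′⊆σ σ<x)) z<p)

  contains-mid : ∀ {a x β y z p} → a < x → All (_< a) β → Any (y <_) p →
    contains (a ∷ x ∷ β) (y ∷ z ∷ p) ≡ contains β (y ∷ z ∷ p)
  contains-mid {a} {x} {β} {y} {z} {p} a<x β<a y<p =
    contains-≡ {y ∷ z ∷ p} {a ∷ x ∷ β} (a ∷ʳ x ∷ʳ ⊆-refl) restrict
    where
    β<x = All.map (λ b<a → <-trans b<a a<x) β<a
    below : ∀ {b s ys} → s ⊆ β → All (_< b) β → Any (y <_) ys → Pointwise (λ u v → SameCmp b u y v) s ys → ⊥
    below s⊆β β<b y<ys pw = not-all-below (below-head pw (All-resp-⊆ s⊆β β<b)) y<ys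
    restrict : Occurs (y ∷ z ∷ p) (a ∷ x ∷ β) → Occurs (y ∷ z ∷ p) β
    restrict (s , _ ∷ʳ _ ∷ʳ s⊆β , s≅p)              = s , s⊆β , s≅p
    restrict (_ , _ ∷ʳ refl ∷ s⊆β , pw ∷ _)         = ⊥-elim (below s⊆β β<x (there y<p) pw)
    restrict (_ , refl ∷ _ ∷ʳ s⊆β , pw ∷ _)         = ⊥-elim (below s⊆β β<a (there y<p) pw)
    restrict (_ , refl ∷ refl ∷ s⊆β , (_ ∷ pw) ∷ _) = ⊥-elim (below s⊆β β<a y<p pw)

  Increasing : List ℕ → Set
  Increasing = AllPairs _<_

  ≅-increasing⁻ : ∀ {s p} → Increasing p → s ≅ p → Increasing s
  ≅-increasing⁻ []           []          = []
  ≅-increasing⁻ (y<p ∷ p↑)   (pw ∷ s≅p)  = above-head pw y<p ∷ ≅-increasing⁻ p↑ s≅p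

  ≅-increasing⁺ : ∀ {s p} → Increasing s → Increasing p → length s ≡ length p → s ≅ p
  ≅-increasing⁺ {[]}    {[]}    []         []         _   = []
  ≅-increasing⁺ {_ ∷ _} {_ ∷ _} (x<s ∷ s↑) (y<p ∷ p↑) |s| =
    pointwise x<s y<p (cong pred |s|) ∷ ≅-increasing⁺ s↑ p↑ (cong pred |s|)
    where
    pointwise : ∀ {x y xs ys} → All (x <_) xs → All (y <_) ys → length xs ≡ length ys →
                Pointwise (λ a b → SameCmp x a y b) xs ys
    pointwise []           []           _    = []
    pointwise (x<a ∷ x<as) (y<b ∷ y<bs) |as| = sameCmp-< x<a y<b ∷ pointwise x<as y<bs (cong pred |as|)

  incr-increasing : ∀ d → Increasing (incr d)
  incr-increasing d = AllPairs.map⁺ (AllPairs.applyUpTo⁺₁ id d (λ i<j _ → s<s i<j))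

  length-incr : ∀ d → length (incr d) ≡ d
  length-incr d = trans (length-map suc (upTo d)) (length-upTo d)

  HasIncreasing : ℕ → List ℕ → Set
  HasIncreasing d π = ∃[ s ] s ⊆ π × Increasing s × length s ≡ d

  occurs-incr⇔ : ∀ d π → Occurs (incr d) π ⇔ HasIncreasing d π
  occurs-incr⇔ d π = mk⇔
    (λ (s , s⊆π , s≅incr) →
      s , s⊆π , ≅-increasing⁻ (incr-increasing d) s≅incr , trans (≅-length s≅incr) (length-incr d))
    (λ (s , s⊆π , s↑ , |s|) → s , s⊆π , ≅-increasing⁺ s↑ (incr-increasing d) (trans |s| (sym (length-incr d))))

  increasing-∷ʳ⁻ : ∀ s {x} → Increasing (s ++ [ x ]) → Increasing s
  increasing-∷ʳ⁻ []      _            = []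
  increasing-∷ʳ⁻ (a ∷ s) (a<s ∷ s↑)   = AllP.++⁻ˡ s a<s ∷ increasing-∷ʳ⁻ s s↑

  length-∷ʳ : ∀ (s : List ℕ) x → length (s ++ [ x ]) ≡ suc (length s)
  length-∷ʳ s x = trans (length-++ s) (ℕₚ.+-comm (length s) 1)

  hasIncreasing-∷ʳ-max : ∀ {x σ} d → All (_< x) σ → HasIncreasing (suc d) (σ ++ [ x ]) ⇔ HasIncreasing d σ
  hasIncreasing-∷ʳ-max {x} {σ} d σ<x = mk⇔ restrict extend
    where
    restrict : HasIncreasing (suc d) (σ ++ [ x ]) → HasIncreasing d σ
    restrict (s , s⊆ , s↑ , |s|) with ⊆-∷ʳ⁻ σ s⊆
    ... | inj₁ s⊆σ                = drop-head s s⊆σ s↑ |s|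
      where
      drop-head : ∀ s → s ⊆ σ → Increasing s → length s ≡ suc d → HasIncreasing d σ
      drop-head (_ ∷ s) s⊆σ (_ ∷ s↑) |s| = s , ∷ˡ⁻ s⊆σ , s↑ , cong pred |s|
    ... | inj₂ (s′ , refl , s′⊆σ) =
      s′ , s′⊆σ , increasing-∷ʳ⁻ s′ s↑ , cong pred (trans (sym (length-∷ʳ s′ x)) |s|)
    extend : HasIncreasing d σ → HasIncreasing (suc d) (σ ++ [ x ])
    extend (s , s⊆σ , s↑ , |s|) =
      s ++ [ x ] , ++⁺ s⊆σ ⊆-refl ,
      AllPairs.++⁺ s↑ ([] ∷ []) (All.map (_∷ []) (All-resp-⊆ s⊆σ σ<x)) ,
      trans (length-∷ʳ s x) (cong suc |s|)

  contains-incr-∷ʳ-max : ∀ {x σ} d → All (_< x) σ → contains (σ ++ [ x ]) (incr (suc d)) ≡ contains σ (incr d)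
  contains-incr-∷ʳ-max {x} {σ} d σ<x = T-injective
    (⇔-sym (T-contains σ (incr d)) ⇔-∘ (⇔-sym (occurs-incr⇔ d σ) ⇔-∘ (hasIncreasing-∷ʳ-max d σ<x
      ⇔-∘ (occurs-incr⇔ (suc d) (σ ++ [ x ]) ⇔-∘ T-contains (σ ++ [ x ]) (incr (suc d))))))

  -- Strict order between numerals, decided by evaluation.
  lit< : ∀ {m n} {_ : T (m <ᵇ n)} → m < n
  lit< {m} {n} {m<ᵇn} = <ᵇ⇒< m n m<ᵇn

  occurs-12 : ∀ {u v π} → u ∷ v ∷ [] ⊆ π → u < v → Occurs (incr 2) π
  occurs-12 uv⊆π u<v = _ , uv⊆π , (sameCmp-< u<v lit< ∷ []) ∷ [] ∷ []

  occurs-132 : ∀ {u v w π} → u ∷ v ∷ w ∷ [] ⊆ π → u < w → w < v → Occurs p132 π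
  occurs-132 uvw⊆π u<w w<v = _ , uvw⊆π ,
    (sameCmp-< (<-trans u<w w<v) lit< ∷ sameCmp-< u<w lit< ∷ []) ∷ (sameCmp-> w<v lit< ∷ []) ∷ [] ∷ []

  occurs-2341 : ∀ {a b x c π} → a ∷ b ∷ x ∷ c ∷ [] ⊆ π → c < a → a < b → b < x → Occurs p2341 π
  occurs-2341 abxc⊆π c<a a<b b<x = _ , abxc⊆π ,
    (sameCmp-< a<b lit< ∷ sameCmp-< (<-trans a<b b<x) lit< ∷ sameCmp-> c<a lit< ∷ []) ∷
    (sameCmp-< b<x lit< ∷ sameCmp-> (<-trans c<a a<b) lit< ∷ []) ∷
    (sameCmp-> (<-trans c<a (<-trans a<b b<x)) lit< ∷ []) ∷ [] ∷ []

  occurs-3241 : ∀ {a b x c π} → a ∷ b ∷ x ∷ c ∷ [] ⊆ π → c < b → b < a → a < x → Occurs p3241 π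
  occurs-3241 abxc⊆π c<b b<a a<x = _ , abxc⊆π ,
    (sameCmp-> b<a lit< ∷ sameCmp-< a<x lit< ∷ sameCmp-> (<-trans c<b b<a) lit< ∷ []) ∷
    (sameCmp-< (<-trans b<a a<x) lit< ∷ sameCmp-> c<b lit< ∷ []) ∷
    (sameCmp-> (<-trans c<b (<-trans b<a a<x)) lit< ∷ []) ∷ [] ∷ []

  good : ℕ → List ℕ → Bool
  good d π = avoids π p132 ∧ avoids π p2341 ∧ avoids π p3241 ∧ avoids π (incr d)

  good-≡ : ∀ {d d′ π π′} →
    contains π p132 ≡ contains π′ p132 → contains π p2341 ≡ contains π′ p2341 →
    contains π p3241 ≡ contains π′ p3241 → contains π (incr d) ≡ contains π′ (incr d′) →
    good d π ≡ good d′ π′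
  good-≡ e₁ e₂ e₃ e₄ =
    cong₂ _∧_ (cong not e₁) (cong₂ _∧_ (cong not e₂) (cong₂ _∧_ (cong not e₃) (cong not e₄)))

  forbidden : ℕ → List (List ℕ)
  forbidden d = p132 ∷ p2341 ∷ p3241 ∷ incr d ∷ []

  good-avoids : ∀ {d π} → T (good d π) → All (λ p → T (avoids π p)) (forbidden d)
  good-avoids g =
    let a , g₁ = to T-∧ g ; b , g₂ = to T-∧ g₁ ; c , e = to T-∧ g₂ in a ∷ b ∷ c ∷ e ∷ []

  ¬T⇒false : ∀ {b} → ¬ T b → b ≡ false
  ¬T⇒false {false} _  = refl
  ¬T⇒false {true}  ¬t = ⊥-elim (¬t tt)

  bad : ∀ {d π p} → p ∈ forbidden d → Occurs p π → good d π ≡ false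
  bad {d} {π} {p} p∈ o = ¬T⇒false λ g →
    subst T (to T-not-≡ (All.lookup (good-avoids {d} {π} g) p∈)) (from (T-contains π p) o)

  bad-132 : ∀ {d π} → Occurs p132 π → good d π ≡ false
  bad-132 = bad (here refl)

  bad-2341 : ∀ {d π} → Occurs p2341 π → good d π ≡ false
  bad-2341 = bad (there (here refl))

  bad-3241 : ∀ {d π} → Occurs p3241 π → good d π ≡ false
  bad-3241 = bad (there (there (here refl)))

  bad-incr : ∀ {d π} → Occurs (incr d) π → good d π ≡ false
  bad-incr = bad (there (there (there (here refl))))

  good-∷-max : ∀ e {x σ} → All (_< x) σ → good (2 + e) (x ∷ σ) ≡ good (2 + e) σ
  good-∷-max e {x} {σ} σ<x = good-≡ {π = x ∷ σ} {σ}
    (contains-∷-max σ<x (here lit<)) (contains-∷-max σ<x (here lit<))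
    (contains-∷-max σ<x (there (here lit<))) (contains-∷-max σ<x (here lit<))

  good-∷ʳ-max : ∀ d {x σ} → All (_< x) σ → good (suc d) (σ ++ [ x ]) ≡ good d σ
  good-∷ʳ-max d {x} {σ} σ<x = good-≡ {π = σ ++ [ x ]} {σ}
    (contains-∷ʳ-max (1 ∷ 3 ∷ []) σ<x (there (here lit<))) (contains-∷ʳ-max (2 ∷ 3 ∷ 4 ∷ []) σ<x (here lit<))
    (contains-∷ʳ-max (3 ∷ 2 ∷ 4 ∷ []) σ<x (here lit<)) (contains-incr-∷ʳ-max d σ<x)

  good-mid : ∀ e {a x β} → a < x → All (_< a) β → good (3 + e) (a ∷ x ∷ β) ≡ good (3 + e) β
  good-mid e {a} {x} {β} a<x β<a = good-≡ {π = a ∷ x ∷ β} {β}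
    (contains-mid a<x β<a (here lit<)) (contains-mid a<x β<a (here lit<))
    (contains-mid a<x β<a (here lit<)) (contains-mid a<x β<a (here lit<))

  record Arrangement (n : ℕ) (σ : List ℕ) : Set where
    field
      bounded  : All (_< suc n) σ
      distinct : Unique σ
      size     : length σ ≡ n

  insertions-All : ∀ {P : ℕ → Set} {x} σ → P x → All P σ → All (All P) (insertions x σ)
  insertions-All []      px []         = (px ∷ []) ∷ []
  insertions-All (y ∷ σ) px (py ∷ pσ) = (px ∷ py ∷ pσ) ∷ AllP.map⁺ (All.map (py ∷_) (insertions-All σ px pσ))

  insertions-Unique : ∀ {x} σ → All (x ≢_) σ → Unique σ → All Unique (insertions x σ)
  insertions-Unique []      []          []           = ([] ∷ []) ∷ []
  insertions-Unique (y ∷ σ) (x≢y ∷ x≢σ) (y≢σ ∷ σ!) = ((x≢y ∷ x≢σ) ∷ y≢σ ∷ σ!) ∷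
    AllP.map⁺ (All.zipWith (λ (y≢ι , ι!) → y≢ι ∷ ι!)
      (insertions-All σ (x≢y ∘ sym) y≢σ , insertions-Unique σ x≢σ σ!))

  insertions-length : ∀ {x} σ → All (λ ι → length ι ≡ suc (length σ)) (insertions x σ)
  insertions-length []      = refl ∷ []
  insertions-length (y ∷ σ) = refl ∷ AllP.map⁺ (All.map (cong suc) (insertions-length σ))

  insertions-∈ : ∀ x σ → All (x ∈_) (insertions x σ)
  insertions-∈ x []      = here refl ∷ []
  insertions-∈ x (y ∷ σ) = here refl ∷ AllP.map⁺ (All.map there (insertions-∈ x σ))

  S-arrangement : ∀ n → All (Arrangement n) (S n)
  S-arrangement zero    = record { bounded = [] ; distinct = [] ; size = refl } ∷ []
  S-arrangement (suc n) = AllP.concat⁺ (AllP.map⁺ (All.map insert (S-arrangement n)))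
    where
    insert : ∀ {σ} → Arrangement n σ → All (Arrangement (suc n)) (insertions (suc n) σ)
    insert {σ} record { bounded = σ≤n ; distinct = σ! ; size = |σ| } =
      All.zipWith
        (λ ((ι≤ , ι!) , |ι|) → record { bounded = ι≤ ; distinct = ι! ; size = trans |ι| (cong suc |σ|) })
        (All.zipWith id
          (insertions-All σ ℕₚ.≤-refl (All.map ℕₚ.m<n⇒m<1+n σ≤n) ,
           insertions-Unique σ (All.map (λ a<1+n 1+n≡a → ℕₚ.<-irrefl (sym 1+n≡a) a<1+n) σ≤n) σ!) ,
         insertions-length σ)

  -- With x the maximum, an entry c after x combines with the first two entries a, b
  -- into 132 (a < c or b < c), 2341 (c < a < b) or 3241 (c < b < a).
  bad-after-max : ∀ d {a b c x} α u → a < x → b < x → c < x → a ≢ b → c ≢ a → c ≢ b →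
    good d (a ∷ b ∷ α ++ x ∷ c ∷ u) ≡ false
  bad-after-max d {a} {b} {c} {x} α u a<x b<x c<x a≢b c≢a c≢b = by-cases (<-cmp a c) (<-cmp b c) (<-cmp a b)
    where
    xc⊆ : x ∷ c ∷ [] ⊆ α ++ x ∷ c ∷ u
    xc⊆ = ++⁺ˡ α (refl ∷ refl ∷ minimum u)
    by-cases : Tri (a < c) (a ≡ c) (c < a) → Tri (b < c) (b ≡ c) (c < b) → Tri (a < b) (a ≡ b) (b < a) →
               good d (a ∷ b ∷ α ++ x ∷ c ∷ u) ≡ false
    by-cases (tri< a<c _ _) _              _              = bad-132 (occurs-132 (refl ∷ b ∷ʳ xc⊆) a<c c<x)
    by-cases (tri≈ _ a≡c _) _              _              = ⊥-elim (c≢a (sym a≡c))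
    by-cases (tri> _ _ _)   (tri< b<c _ _) _              = bad-132 (occurs-132 (a ∷ʳ refl ∷ xc⊆) b<c c<x)
    by-cases (tri> _ _ _)   (tri≈ _ b≡c _) _              = ⊥-elim (c≢b (sym b≡c))
    by-cases (tri> _ _ c<a) (tri> _ _ _)   (tri< a<b _ _) = bad-2341 (occurs-2341 (refl ∷ refl ∷ xc⊆) c<a a<b b<x)
    by-cases (tri> _ _ _)   (tri> _ _ _)   (tri≈ _ a≡b _) = ⊥-elim (a≢b a≡b)
    by-cases (tri> _ _ _)   (tri> _ _ c<b) (tri> _ _ b<a) = bad-3241 (occurs-3241 (refl ∷ refl ∷ xc⊆) c<b b<a a<x)

  -- countP (incr d) n is count (good d) (S n) by definition.
  count : {A : Set} → (A → Bool) → List A → ℕ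
  count P L = length (filterᵇ P L)

  indicator : Bool → ℕ
  indicator true  = 1
  indicator false = 0

  count-∷ : ∀ {A : Set} (P : A → Bool) σ L → count P (σ ∷ L) ≡ indicator (P σ) + count P L
  count-∷ P σ L with P σ
  ... | true  = refl
  ... | false = refl

  count-++ : ∀ {A : Set} (P : A → Bool) xs ys → count P (xs ++ ys) ≡ count P xs + count P ys
  count-++ P []       ys = refl
  count-++ P (σ ∷ xs) ys = begin
    count P (σ ∷ xs ++ ys)                       ≡⟨ count-∷ P σ (xs ++ ys) ⟩
    indicator (P σ) + count P (xs ++ ys)         ≡⟨ cong (indicator (P σ) +_) (count-++ P xs ys) ⟩
    indicator (P σ) + (count P xs + count P ys)  ≡⟨ ℕₚ.+-assoc (indicator (P σ)) _ _ ⟨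
    indicator (P σ) + count P xs + count P ys    ≡⟨ cong (_+ count P ys) (count-∷ P σ xs) ⟨
    count P (σ ∷ xs) + count P ys                ∎
    where open ≡-Reasoning

  count-concatMap : ∀ {A B : Set} (P : B → Bool) (f : A → List B) L →
    count P (concatMap f L) ≡ sum (map (count P ∘ f) L)
  count-concatMap P f []      = refl
  count-concatMap P f (σ ∷ L) =
    trans (count-++ P (f σ) (concatMap f L)) (cong (count P (f σ) +_) (count-concatMap P f L))

  count-as-sum : ∀ {A : Set} (P : A → Bool) L → count P L ≡ sum (map (indicator ∘ P) L)
  count-as-sum P []      = refl
  count-as-sum P (σ ∷ L) = trans (count-∷ P σ L) (cong (indicator (P σ) +_) (count-as-sum P L))

  count-cong : ∀ {A : Set} {P Q : A → Bool} {L} → All (λ σ → P σ ≡ Q σ) L → count P L ≡ count Q L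
  count-cong {P = P} {Q} {L} P≡Q = begin
    count P L                  ≡⟨ count-as-sum P L ⟩
    sum (map (indicator ∘ P) L) ≡⟨ cong sum (map-cong-local (All.map (cong indicator) P≡Q)) ⟩
    sum (map (indicator ∘ Q) L) ≡⟨ count-as-sum Q L ⟨
    count Q L                  ∎
    where open ≡-Reasoning

  count-none : ∀ {A : Set} {P : A → Bool} L → All (λ σ → P σ ≡ false) L → count P L ≡ 0
  count-none {P = P} L P≡false = trans (count-cong P≡false) (trans (count-as-sum (const false) L) (sum-zeros L))
    where
    sum-zeros : ∀ (L : List _) → sum (map (indicator ∘ const false) L) ≡ 0
    sum-zeros []      = refl
    sum-zeros (_ ∷ L) = sum-zeros L

  sum-map-+ : ∀ {A : Set} (f g : A → ℕ) L → sum (map (λ σ → f σ + g σ) L) ≡ sum (map f L) + sum (map g L)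
  sum-map-+ f g []      = refl
  sum-map-+ f g (σ ∷ L) =
    trans (cong (f σ + g σ +_) (sum-map-+ f g L)) (interchange (f σ) (g σ) (sum (map f L)) (sum (map g L)))

  count-insertions-head : ∀ (P : List ℕ → Bool) {x a} σ → All (λ ι → P (a ∷ ι) ≡ false) (insertions x σ) →
    count P (insertions x (a ∷ σ)) ≡ indicator (P (x ∷ a ∷ σ))
  count-insertions-head P {x} {a} σ rest-bad = begin
    count P (insertions x (a ∷ σ))
      ≡⟨ count-∷ P (x ∷ a ∷ σ) (map (a ∷_) (insertions x σ)) ⟩
    indicator (P (x ∷ a ∷ σ)) + count P (map (a ∷_) (insertions x σ))
      ≡⟨ cong (indicator (P (x ∷ a ∷ σ)) +_) (count-none _ (AllP.map⁺ rest-bad)) ⟩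
    indicator (P (x ∷ a ∷ σ)) + 0
      ≡⟨ ℕₚ.+-identityʳ _ ⟩
    indicator (P (x ∷ a ∷ σ)) ∎
    where open ≡-Reasoning

  count-map-insertions : ∀ (P : List ℕ → Bool) (C : List ℕ → List ℕ) x t →
    All (λ c → ∀ α u → P (C (α ++ x ∷ c ∷ u)) ≡ false) t →
    count P (map C (insertions x t)) ≡ indicator (P (C (t ++ [ x ])))
  count-map-insertions P C x []      []            = trans (count-∷ P (C [ x ]) []) (ℕₚ.+-identityʳ _)
  count-map-insertions P C x (c ∷ t) (c-bad ∷ t-bad) = begin
    count P (C (x ∷ c ∷ t) ∷ map C (map (c ∷_) (insertions x t)))
      ≡⟨ count-∷ P (C (x ∷ c ∷ t)) (map C (map (c ∷_) (insertions x t))) ⟩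
    indicator (P (C (x ∷ c ∷ t))) + count P (map C (map (c ∷_) (insertions x t)))
      ≡⟨ cong₂ _+_ (cong indicator (c-bad [] t)) (cong (count P) (sym (map-∘ (insertions x t)))) ⟩
    0 + count P (map (C ∘ (c ∷_)) (insertions x t))
      ≡⟨ count-map-insertions P (C ∘ (c ∷_)) x t (All.map (λ bad α u → bad (c ∷ α) u) t-bad) ⟩
    indicator (P (C (c ∷ t ++ [ x ])))                                              ∎
    where open ≡-Reasoning

  insertSecond : ℕ → List ℕ → List ℕ
  insertSecond x []      = [ x ]
  insertSecond x (a ∷ σ) = a ∷ x ∷ σ

  count-insertions : ∀ d {x a b} t → let σ = a ∷ b ∷ t in All (_< x) σ → Unique σ →
    count (good d) (insertions x σ)
      ≡ indicator (good d (x ∷ σ)) + indicator (good d (insertSecond x σ)) + indicator (good d (σ ++ [ x ]))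
  count-insertions d {x} {a} {b} t (a<x ∷ b<x ∷ t<x) ((a≢b ∷ a≢t) ∷ b≢t ∷ _) = begin
    count (good d) ((x ∷ a ∷ b ∷ t) ∷ (a ∷ x ∷ b ∷ t) ∷ map (a ∷_) (map (b ∷_) (insertions x t)))
      ≡⟨ count-∷ (good d) (x ∷ a ∷ b ∷ t) ((a ∷ x ∷ b ∷ t) ∷ map (a ∷_) (map (b ∷_) (insertions x t))) ⟩
    front + count (good d) ((a ∷ x ∷ b ∷ t) ∷ map (a ∷_) (map (b ∷_) (insertions x t)))
      ≡⟨ cong (front +_) (count-∷ (good d) (a ∷ x ∷ b ∷ t) (map (a ∷_) (map (b ∷_) (insertions x t)))) ⟩
    front + (second + count (good d) (map (a ∷_) (map (b ∷_) (insertions x t))))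
      ≡⟨ cong (λ n → front + (second + n)) (cong (count (good d)) (map-∘ (insertions x t))) ⟨
    front + (second + count (good d) (map (λ ι → a ∷ b ∷ ι) (insertions x t)))
      ≡⟨ cong (λ n → front + (second + n))
              (count-map-insertions (good d) (λ ι → a ∷ b ∷ ι) x t (after-max t<x a≢t b≢t)) ⟩
    front + (second + indicator (good d (a ∷ b ∷ t ++ [ x ])))
      ≡⟨ ℕₚ.+-assoc front second _ ⟨
    front + second + indicator (good d (a ∷ b ∷ t ++ [ x ]))  ∎
    where
    open ≡-Reasoning
    front = indicator (good d (x ∷ a ∷ b ∷ t))
    second = indicator (good d (a ∷ x ∷ b ∷ t))
    after-max : ∀ {t} → All (_< x) t → All (a ≢_) t → All (b ≢_) t →
                All (λ c → ∀ α u → good d (a ∷ b ∷ α ++ x ∷ c ∷ u) ≡ false) t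
    after-max []           []           []           = []
    after-max (c<x ∷ t<x) (a≢c ∷ a≢t) (b≢c ∷ b≢t) =
      (λ α u → bad-after-max d α u a<x b<x c<x a≢b (a≢c ∘ sym) (b≢c ∘ sym)) ∷ after-max t<x a≢t b≢t

  countP-incr1 : ∀ n → countP (incr 1) (suc n) ≡ 0
  countP-incr1 n = count-none (S (suc n)) (All.map contains-1 (S-arrangement (suc n)))
    where
    contains-1 : ∀ {σ} → Arrangement (suc n) σ → good 1 σ ≡ false
    contains-1 {x ∷ σ} _ = bad-incr (_ , refl ∷ minimum σ , [] ∷ [])

  countP-incr2 : ∀ n → countP (incr 2) n ≡ 1
  countP-incr2 0             = refl
  countP-incr2 1             = refl
  countP-incr2 (suc (suc m)) = begin
    count (good 2) (concatMap (insertions x) (S (suc m)))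
      ≡⟨ count-concatMap (good 2) (insertions x) (S (suc m)) ⟩
    sum (map (count (good 2) ∘ insertions x) (S (suc m)))
      ≡⟨ cong sum (map-cong-local (All.map front-only (S-arrangement (suc m)))) ⟩
    sum (map (indicator ∘ good 2) (S (suc m)))
      ≡⟨ count-as-sum (good 2) (S (suc m)) ⟨
    count (good 2) (S (suc m))
      ≡⟨ countP-incr2 (suc m) ⟩
    1 ∎
    where
    open ≡-Reasoning
    x = 2 + m
    front-only : ∀ {σ} → Arrangement (suc m) σ → count (good 2) (insertions x σ) ≡ indicator (good 2 σ)
    front-only {a ∷ σ} record { bounded = σ<x@(a<x ∷ _) } = trans
      (count-insertions-head (good 2) σ
        (All.map (λ x∈ι → bad-incr (occurs-12 (refl ∷ from∈ x∈ι) a<x)) (insertions-∈ x σ)))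
      (cong indicator (good-∷-max 0 σ<x))

  count-insertSecond : ∀ e m →
    count (good (3 + e) ∘ insertSecond (3 + m)) (S (2 + m)) ≡ countP (incr (3 + e)) (1 + m)
  count-insertSecond e m = begin
    count Q (concatMap (insertions y) (S (1 + m)))
      ≡⟨ count-concatMap Q (insertions y) (S (1 + m)) ⟩
    sum (map (count Q ∘ insertions y) (S (1 + m)))
      ≡⟨ cong sum (map-cong-local (All.map y-first-only (S-arrangement (1 + m)))) ⟩
    sum (map (indicator ∘ good d) (S (1 + m)))
      ≡⟨ count-as-sum (good d) (S (1 + m)) ⟨
    count (good d) (S (1 + m)) ∎
    where
    open ≡-Reasoning
    d = 3 + e
    x = 3 + m
    y = 2 + m
    Q = good d ∘ insertSecond x
    y<x = ℕₚ.n<1+n y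
    -- With y inserted later, t x … y is a 132.
    y-first-only : ∀ {τ} → Arrangement (1 + m) τ → count Q (insertions y τ) ≡ indicator (good d τ)
    y-first-only {t ∷ τ} record { bounded = τ<y@(t<y ∷ _) } = trans
      (count-insertions-head Q τ
        (All.map (λ y∈ι → bad-132 (occurs-132 (refl ∷ refl ∷ from∈ y∈ι) t<y y<x)) (insertions-∈ y τ)))
      (cong indicator (good-mid e y<x τ<y))

  countP-recurrence : ∀ e m → let N d n = countP (incr d) n in
    N (3 + e) (3 + m) ≡ N (3 + e) (2 + m) + N (3 + e) (1 + m) + N (2 + e) (2 + m)
  countP-recurrence e m = begin
    count (good d) (concatMap (insertions x) S₂)
      ≡⟨ count-concatMap (good d) (insertions x) S₂ ⟩
    sum (map (count (good d) ∘ insertions x) S₂)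
      ≡⟨ cong sum (map-cong-local (All.map split (S-arrangement (2 + m)))) ⟩
    sum (map (λ σ → front σ + second σ + last σ) S₂)
      ≡⟨ trans (sum-map-+ (λ σ → front σ + second σ) last S₂)
               (cong (_+ sum (map last S₂)) (sum-map-+ front second S₂)) ⟩
    sum (map front S₂) + sum (map second S₂) + sum (map last S₂)
      ≡⟨ cong₂ _+_ (cong₂ _+_ (count-as-sum (good d ∘ (x ∷_)) S₂) (count-as-sum (good d ∘ insertSecond x) S₂))
                   (count-as-sum (good d ∘ (_++ [ x ])) S₂) ⟨
    count (good d ∘ (x ∷_)) S₂ + count (good d ∘ insertSecond x) S₂ + count (good d ∘ (_++ [ x ])) S₂
      ≡⟨ cong₂ _+_
           (cong₂ _+_ (count-cong (All.map (good-∷-max (suc e) ∘ Arrangement.bounded) (S-arrangement (2 + m))))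
                      (count-insertSecond e m))
           (count-cong (All.map (good-∷ʳ-max (2 + e) ∘ Arrangement.bounded) (S-arrangement (2 + m)))) ⟩
    count (good d) S₂ + count (good d) (S (1 + m)) + count (good (2 + e)) S₂ ∎
    where
    open ≡-Reasoning
    d = 3 + e
    x = 3 + m
    S₂ = S (2 + m)
    front second last : List ℕ → ℕ
    front  σ = indicator (good d (x ∷ σ))
    second σ = indicator (good d (insertSecond x σ))
    last   σ = indicator (good d (σ ++ [ x ]))
    split : ∀ {σ} → Arrangement (2 + m) σ → count (good d) (insertions x σ) ≡ front σ + second σ + last σ
    split {a ∷ b ∷ t} record { bounded = σ<x ; distinct = σ! } = count-insertions d t σ<x σ!

open PowerSeries
open Patterns
open import Data.Nat.Base using (zero; suc; _+_; z≤n; s≤s)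
open import Data.Product.Base using (_,_)
import Data.Integer.Base as ℤ
open import Data.Integer.Properties using (pos-+)
open import Function.Base using (_∘_)
open import Relation.Binary.PropositionalEquality using (_≡_; refl; trans; cong)

mainTheorem4 : (genP (incr 1) ≈ˢ one)
    × ((one ⊖ X) ⊗ genP (incr 2) ≈ˢ one)
    × ((d : ℕ) → 3 ≤ d →
        (one ⊖ X) ⊗ q ^ˢ (d ∸ 2) ⊗ genP (incr d)
          ≈ˢ (one ⊖ X) ⊗ sumS (d ∸ 3) (λ r → q ^ˢ (r Data.Nat.+ 1) ⊗ X ^ˢ (d ∸ 3 ∸ r))
             ⊕ X ^ˢ (d ∸ 2))
mainTheorem4 = avoiding-1 , avoiding-12 , λ
  { (suc (suc (suc e))) (s≤s (s≤s (s≤s z≤n))) → closedForm-from-recurrence (genP ∘ incr) avoiding-12 recurrence e }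
  where
  avoiding-1 : genP (incr 1) ≈ˢ one
  avoiding-1 zero    = refl
  avoiding-1 (suc n) = cong ℤ.+_ (countP-incr1 n)

  avoiding-12 : (one ⊖ X) ⊗ genP (incr 2) ≈ˢ one
  avoiding-12 = geometric-series (cong ℤ.+_ ∘ countP-incr2)

  recurrence : ∀ e → q ⊗ genP (incr (3 + e)) ≈ˢ q ⊕ X ⊗ genP (incr (2 + e))
  -- The initial values a_d(0) = a_d(1) = 1 and a_d(2) = 2 hold by evaluation.
  recurrence e = q⊗-recurrence refl refl refl refl refl λ m → trans (cong ℤ.+_ (countP-recurrence e m))
    (pos-+₃ (countP (incr (3 + e)) (2 + m)) (countP (incr (3 + e)) (1 + m)) (countP (incr (2 + e)) (2 + m)))
    where
    pos-+₃ : ∀ a b c → ℤ.+ (a + b + c) ≡ ℤ.+ a ℤ.+ ℤ.+ b ℤ.+ ℤ.+ c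
    pos-+₃ a b c = trans (pos-+ (a + b) c) (cong (ℤ._+ ℤ.+ c) (pos-+ a b))
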